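{- Let $\mathcal{I} = (G,T,\mathcal{R},k)$ be a Node Multiway Cut-Uncut instance and let $v \in V(G) \setminus T$. Assume that there exist $k+2$ paths $P_1,P_2,\ldots,P_{k+2}$ in $G$, such that: (i) for each $1 \leq i \leq k+2$, the path $P_i$ is a simple path that starts at $v$ and ends at $v_i \in T$; (ii) the paths $P_i$ have pairwise disjoint sets of vertices, except for the vertex $v$; (iii) for any $i \neq j$, $(v_i,v_j) \notin \mathcal{R}$. Then for any solution $X$ to $\mathcal{I}$ we have $v \in X$.
   Context: A Node Multiway Cut-Uncut instance $(G,T,\mathcal{R},k)$ consists of a graph $G$, a set of terminals $T\subseteq V(G)$, an equivalence relation $\mathcal{R}$ on $T$, and an integer $k$. A solution is a set $X\subseteq V(G)\setminus T$ with $|X|\le k$ such that for any $u,w\in T$, $u$ and $w$ belong to the same connected component of $G\setminus X$ if and only if $(u,w)\in\mathcal{R}$. -}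

module Defs where

open import Data.Nat using (ℕ; _≤_)
open import Data.Fin using (Fin)
open import Data.Fin.Subset using (Subset; _∈_; _∉_; ∣_∣)
open import Data.List using (List; []; _∷_; head; last)
open import Data.List.Membership.Propositional using () renaming (_∈_ to _∈L_)
open import Data.List.Relation.Unary.All using (All)
open import Data.List.Relation.Unary.Unique.Propositional using (Unique)
open import Data.Maybe using (just)
open import Data.Product using (Σ; _×_; proj₁)
open import Relation.Binary using (Rel; IsEquivalence)
open import Relation.Binary.PropositionalEquality using (_≡_)
open import Relation.Nullary using (¬_)
open import Level using (0ℓ)

record Graph (n : ℕ) : Set₁ where
  field
    Adj   : Fin n → Fin n → Set
    sym   : ∀ {u w} → Adj u w → Adj w u
    irref : ∀ {u} → ¬ Adj u u
open Graph public

data IsWalk {n : ℕ} (G : Graph n) : List (Fin n) → Set where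
  single : ∀ u → IsWalk G (u ∷ [])
  step   : ∀ u w ws → Adj G u w → IsWalk G (w ∷ ws) → IsWalk G (u ∷ w ∷ ws)

IsSimplePath : ∀ {n} → Graph n → List (Fin n) → Set
IsSimplePath G ps = IsWalk G ps × Unique ps

Connected∖ : ∀ {n} → Graph n → Subset n → Fin n → Fin n → Set
Connected∖ {n} G X u w =
  Σ (List (Fin n)) λ ps →
    IsWalk G ps × All (λ x → x ∉ X) ps × head ps ≡ just u × last ps ≡ just w

Term : ∀ {n} → Subset n → Set
Term {n} T = Σ (Fin n) (λ t → t ∈ T)

record Instance (n : ℕ) : Set₁ where
  field
    graph : Graph n
    T     : Subset n
    R     : Rel (Term T) 0ℓ
    R-equiv : IsEquivalence R
    k     : ℕ
open Instance public

record IsSolution {n : ℕ} (I : Instance n) (X : Subset n) : Set where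
  field
    disjointT : ∀ x → x ∈ X → x ∉ T I
    size      : ∣ X ∣ ≤ k I
    cutUncut₁ : ∀ (u w : Term (T I)) →
                Connected∖ (graph I) X (proj₁ u) (proj₁ w) → R I u w
    cutUncut₂ : ∀ (u w : Term (T I)) →
                R I u w → Connected∖ (graph I) X (proj₁ u) (proj₁ w)

-- Each of the k + 2 paths either avoids X or meets it; a path
-- meeting X is labelled by a vertex of X it contains, an avoiding path by a fresh label.
-- Only ∣X∣ + 1 ≤ k + 1 labels exist, so two paths share a label. Two avoiding paths would
-- connect their unrelated endpoints through v in G ∖ X; two paths meeting X in the same
-- vertex can only share v, so that vertex is v and v ∈ X.
module Submission where

open import Defs
open import Data.Nat using (ℕ; _+_; suc; s≤s) renaming (_<_ to _<ℕ_)
open import Data.Nat.Properties using (≤-trans; ≤-reflexive; +-comm)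
open import Data.Fin using (Fin; zero; suc)
open import Data.Fin.Properties using (pigeonhole; <⇒≢; suc-injective)
open import Data.Fin.Subset using (Subset; _∈_; _∉_; ∣_∣; inside; outside)
open import Data.Fin.Subset.Properties using (_∈?_)
open import Data.Vec using (_∷_) renaming (here to vhere; there to vthere)
open import Data.List using (List; head; last; []; _∷_)
open import Data.List.Membership.Propositional using (find) renaming (_∈_ to _∈L_)
open import Data.List.Relation.Unary.All using (All; []; _∷_)
open import Data.List.Relation.Unary.All.Properties using (¬Any⇒All¬)
open import Data.List.Relation.Unary.Any using (any?)
open import Data.Maybe using (just)
open import Data.Product using (∃; ∃₂; _×_; _,_)
open import Data.Sum using (_⊎_; inj₁; inj₂)
open import Data.Empty using (⊥-elim)
open import Relation.Binary.PropositionalEquality using (_≡_; _≢_; refl; cong; subst)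
open import Relation.Nullary using (¬_; yes; no)

module _ {n : ℕ} (G : Graph n) (X : Subset n) where

  Connected∖-refl : ∀ {a} → a ∉ X → Connected∖ G X a a
  Connected∖-refl {a} a∉X = a ∷ [] , single a , a∉X ∷ [] , refl , refl

  Connected∖-step : ∀ {a b c} → Adj G a b → a ∉ X → Connected∖ G X b c → Connected∖ G X a c
  Connected∖-step e a∉X ([] , _ , _ , () , _)
  Connected∖-step {a} {b} e a∉X (.b ∷ ps , W , A , refl , l) =
    a ∷ b ∷ ps , step a b ps e W , a∉X ∷ A , refl , l

  walk-then : ∀ {a b c} ps → IsWalk G ps → All (_∉ X) ps →
              head ps ≡ just a → last ps ≡ just b → Connected∖ G X b c → Connected∖ G X a c
  walk-then .(a ∷ []) (single a) _ refl refl bc = bc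
  walk-then .(a ∷ w ∷ ws) (step a w ws e W) (a∉X ∷ A) refl l bc =
    Connected∖-step e a∉X (walk-then (w ∷ ws) W A refl l bc)

  Connected∖-trans : ∀ {a b c} → Connected∖ G X a b → Connected∖ G X b c → Connected∖ G X a c
  Connected∖-trans (ps , W , A , h , l) = walk-then ps W A h l

  walk-reverse : ∀ {a b} ps → IsWalk G ps → All (_∉ X) ps →
                 head ps ≡ just a → last ps ≡ just b → Connected∖ G X b a
  walk-reverse .(a ∷ []) (single a) A refl refl = a ∷ [] , single a , A , refl , refl
  walk-reverse .(a ∷ w ∷ ws) (step a w ws e W) (a∉X ∷ A@(w∉X ∷ _)) refl l =
    Connected∖-trans (walk-reverse (w ∷ ws) W A refl l)
                     (Connected∖-step (sym G e) w∉X (Connected∖-refl a∉X))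

  Connected∖-sym : ∀ {a b} → Connected∖ G X a b → Connected∖ G X b a
  Connected∖-sym (ps , W , A , h , l) = walk-reverse ps W A h l

rank : ∀ {n} {x : Fin n} (p : Subset n) → x ∈ p → Fin ∣ p ∣
rank (inside ∷ p) vhere = zero
rank (inside ∷ p) (vthere x∈p) = suc (rank p x∈p)
rank (outside ∷ p) (vthere x∈p) = rank p x∈p

rank-injective : ∀ {n} {x y : Fin n} (p : Subset n) (x∈p : x ∈ p) (y∈p : y ∈ p) →
                 rank p x∈p ≡ rank p y∈p → x ≡ y
rank-injective (inside ∷ p) vhere vhere _ = refl
rank-injective (inside ∷ p) (vthere x∈p) (vthere y∈p) e =
  cong suc (rank-injective p x∈p y∈p (suc-injective e))
rank-injective (outside ∷ p) (vthere x∈p) (vthere y∈p) e = cong suc (rank-injective p x∈p y∈p e)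

module _ {n : ℕ} (X : Subset n) where

  Hits : List (Fin n) → Set
  Hits xs = ∃ λ x → x ∈L xs × x ∈ X

  avoids-or-hits : ∀ xs → All (_∉ X) xs ⊎ Hits xs
  avoids-or-hits xs with any? (_∈? X) xs
  ... | yes hit = inj₂ (find hit)
  ... | no ¬hit = inj₁ (¬Any⇒All¬ xs ¬hit)

  label : ∀ {xs} → All (_∉ X) xs ⊎ Hits xs → Fin (suc ∣ X ∣)
  label (inj₁ _) = zero
  label (inj₂ (_ , _ , x∈X)) = suc (rank X x∈X)

  Shared : List (Fin n) → List (Fin n) → Set
  Shared xs ys = ∃ λ x → x ∈ X × x ∈L xs × x ∈L ys

  label-collision : ∀ {xs ys} (cx : All (_∉ X) xs ⊎ Hits xs) (cy : All (_∉ X) ys ⊎ Hits ys) →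
                    label cx ≡ label cy → (All (_∉ X) xs × All (_∉ X) ys) ⊎ Shared xs ys
  label-collision (inj₁ xs-avoids) (inj₁ ys-avoids) _ = inj₁ (xs-avoids , ys-avoids)
  label-collision (inj₂ (x , x∈xs , x∈X)) (inj₂ (y , y∈ys , y∈X)) e
    with rank-injective X x∈X y∈X (suc-injective e)
  ... | refl = inj₂ (x , x∈X , x∈xs , y∈ys)

  two-avoid-or-share : ∀ {m} (xss : Fin m → List (Fin n)) → suc ∣ X ∣ <ℕ m →
                       ∃₂ λ i j → i ≢ j ×
                         ((All (_∉ X) (xss i) × All (_∉ X) (xss j)) ⊎ Shared (xss i) (xss j))
  two-avoid-or-share xss bound
    with i , j , i<j , same-label ← pigeonhole bound (λ i → label (avoids-or-hits (xss i)))
    = i , j , <⇒≢ i<j , label-collision (avoids-or-hits (xss i)) (avoids-or-hits (xss j)) same-label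

lemma32 : ∀ {n} (I : Instance n) (v : Fin n) → v ∉ T I →
    (P : Fin (k I + 2) → List (Fin n)) →
    (vs : Fin (k I + 2) → Fin n) →
    (vsT : ∀ i → vs i ∈ T I) →
    (∀ i → IsSimplePath (graph I) (P i) × head (P i) ≡ just v × last (P i) ≡ just (vs i)) →
    (∀ i j → ¬ i ≡ j → ∀ x → x ∈L P i → x ∈L P j → x ≡ v) →
    (∀ i j → ¬ i ≡ j → ¬ R I (vs i , vsT i) (vs j , vsT j)) →
    ∀ (X : Subset n) → IsSolution I X → v ∈ X
lemma32 I v _ P vs vsT paths disjoint unrelated X sol
  with two-avoid-or-share X P (≤-trans (s≤s (s≤s (IsSolution.size sol))) (≤-reflexive (+-comm 2 (k I))))
... | i , j , i≢j , inj₁ (Pi-avoids , Pj-avoids) =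
  ⊥-elim (unrelated i j i≢j (IsSolution.cutUncut₁ sol (vs i , vsT i) (vs j , vsT j)
    (Connected∖-trans G X (Connected∖-sym G X (path-connects i Pi-avoids)) (path-connects j Pj-avoids))))
  where
    G : Graph _
    G = graph I
    path-connects : ∀ i → All (_∉ X) (P i) → Connected∖ G X v (vs i)
    path-connects i avoids with (walk , _) , starts , ends ← paths i = P i , walk , avoids , starts , ends
... | i , j , i≢j , inj₂ (x , x∈X , x∈Pi , x∈Pj) = subst (_∈ X) (disjoint i j i≢j x x∈Pi x∈Pj) x∈X
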